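{- Let $T$ be a tree of order $n$ with $\operatorname{diam}(T)\geq 3$ such that $\gamma_{t,coi}(T)=n-|L(T)|$. If $S^\ast(T)=\emptyset$, then $V(T)=L(T)\cup S(T)$.
   Context: All graphs are finite, simple and undirected. For a graph $G$, a set $D\subseteq V(G)$ is a total dominating set if every vertex of $G$ has at least one neighbor in $D$. A total dominating set $D$ is a total co-independent dominating set if $V(G)\setminus D$ is nonempty and independent. $\gamma_{t,coi}(G)$ is the minimum cardinality of a total co-independent dominating set of $G$. For a tree $T$: a leaf is a vertex of degree one and $L(T)$ is the set of leaves; a support vertex is a non-leaf vertex adjacent to a leaf, and $S(T)$ is the set of support vertices; an isolated support vertex is a support vertex having no neighbor in $S(T)$, and $S^\ast(T)$ is the set of isolated support vertices. -}

module Defs where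

open import Data.Nat using (ℕ; zero; suc; _+_; _∸_; _≤_; _≡ᵇ_)
open import Data.Fin using (Fin)
open import Data.Fin.Subset using (Subset; _∈_; _∉_; ∣_∣; Nonempty)
open import Data.Bool using (Bool; true; false; T; not; _∧_)
open import Data.Vec using (Vec; tabulate; countᵇ)
open import Data.List using (List; []; _∷_; length)
open import Data.List.Relation.Unary.Unique.Propositional using (Unique)
open import Data.Product using (Σ; ∃; _×_; _,_)
open import Relation.Binary.PropositionalEquality using (_≡_)
open import Relation.Nullary using (¬_)

record Graph (n : ℕ) : Set where
  field
    adj   : Fin n → Fin n → Bool
    sym   : ∀ u v → adj u v ≡ adj v u
    irrefl : ∀ v → adj v v ≡ false
open Graph public

module _ {n : ℕ} (G : Graph n) where

  Adj : Fin n → Fin n → Set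
  Adj u v = T (adj G u v)

  data Walk : Fin n → Fin n → ℕ → Set where
    here : ∀ {u} → Walk u u zero
    step : ∀ {u v w k} → Adj u v → Walk v w k → Walk u w (suc k)

  walkVertices : ∀ {u v k} → Walk u v k → List (Fin n)
  walkVertices {u} here = u ∷ []
  walkVertices {u} (step _ p) = u ∷ walkVertices p

  Connected : Set
  Connected = ∀ u v → ∃ λ k → Walk u v k

  -- a cycle: a path v → … → u on at least 3 distinct vertices,
  -- closed by the edge u v
  HasCycle : Set
  HasCycle = Σ (Fin n) λ u → Σ (Fin n) λ v → Σ ℕ λ k →
             Σ (Walk v u (suc (suc k))) λ p →
             Unique (walkVertices p) × Adj u v

  IsTree : Set
  IsTree = Connected × ¬ HasCycle

  DistAtLeast : Fin n → Fin n → ℕ → Set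
  DistAtLeast u v d = ∀ k → Walk u v k → d ≤ k

  DiamAtLeast : ℕ → Set
  DiamAtLeast d = ∃ λ u → ∃ λ v → DistAtLeast u v d

  degree : Fin n → ℕ
  degree v = countᵇ (adj G v) (tabulate (λ u → u))

  isLeaf : Fin n → Bool
  isLeaf v = degree v ≡ᵇ 1

  leaves : Subset n
  leaves = tabulate isLeaf

  IsSupport : Fin n → Set
  IsSupport v = ¬ T (isLeaf v) × ∃ λ u → Adj v u × T (isLeaf u)

  IsIsolatedSupport : Fin n → Set
  IsIsolatedSupport v = IsSupport v × (∀ u → Adj v u → ¬ IsSupport u)

  TotalDominating : Subset n → Set
  TotalDominating D = ∀ v → ∃ λ u → Adj v u × u ∈ D

  TotalCoIndDominating : Subset n → Set
  TotalCoIndDominating D =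
    TotalDominating D
    × (∃ λ v → v ∉ D)
    × (∀ u v → u ∉ D → v ∉ D → ¬ Adj u v)

  GammaTCoiIs : ℕ → Set
  GammaTCoiIs m =
    (∃ λ D → TotalCoIndDominating D × ∣ D ∣ ≡ m)
    × (∀ D → TotalCoIndDominating D → m ≤ ∣ D ∣)

module Submission where

-- Suppose a vertex v of T is neither a leaf nor a support
-- vertex.  Then D = V(T) ∖ (L(T) ∪ {v}) is a total co-independent
-- dominating set of T of size n - |L(T)| - 1, contradicting
-- γ_{t,coi}(T) = n - |L(T)|:
--   * co-independence: two leaves are never adjacent (else T would be K₂,
--     which has no non-leaf vertex v), and v has no leaf neighbour;
--   * total domination: if all neighbours of a vertex u lay outside D,
--     then u would be a leaf (contradicting co-independence), or an
--     isolated support vertex (excluded by hypothesis), or a vertex whose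
--     only neighbour is v, i.e. a leaf after all.

open import Defs
open import Data.Nat using (ℕ; _∸_; suc; _≤_; _<_; z≤n; s≤s)
open import Data.Nat.Properties using (≡ᵇ⇒≡; ≡⇒≡ᵇ; ≤-trans; <⇒≱)
open import Data.Fin using (Fin; zero; suc)
open import Data.Fin.Properties using (_≟_; any?)
open import Data.Fin.Subset using (Subset; _∈_; _∉_; _⊆_; ∣_∣; ∁; _-_; ⁅_⁆)
open import Data.Fin.Subset.Properties
  using (_∈?_; x∈⁅x⁆; x∈⁅y⁆⇒x≡y; ∣⁅x⁆∣≡1; ⊆-antisym; x∉p⇒x∈∁p; ∣∁p∣≡n∸∣p∣;
         x∈p∧x≢y⇒x∈p-y; x∈p⇒∣p-x∣<∣p∣)
open import Data.Bool using (Bool; true; false; T)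
open import Data.Bool.Properties using (T-≡)
open import Data.Vec using (_∷_; tabulate; countᵇ; here; there)
open import Data.Vec.Properties using (lookup∘tabulate; []=⇒lookup; lookup⇒[]=)
open import Data.Product using (_×_; _,_; ∃; proj₁; proj₂)
open import Data.Sum using (_⊎_; inj₁; inj₂; [_,_])
open import Data.Empty using (⊥-elim)
open import Function using (_∘_; id; Equivalence)
open import Relation.Nullary using (¬_; Dec; yes; no; contradiction)
open import Relation.Nullary.Decidable using (T?; _×-dec_)
open import Relation.Binary.PropositionalEquality as ≡ using (_≡_; _≢_; refl; cong; subst)

T⇒∈tabulate : ∀ {n} {f : Fin n → Bool} {w : Fin n} → T (f w) → w ∈ tabulate f
T⇒∈tabulate {f = f} {w} t =
  lookup⇒[]= w (tabulate f) (≡.trans (lookup∘tabulate f w) (Equivalence.to T-≡ t))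

∈tabulate⇒T : ∀ {n} {f : Fin n → Bool} {w : Fin n} → w ∈ tabulate f → T (f w)
∈tabulate⇒T {f = f} {w} w∈ =
  Equivalence.from T-≡ (≡.trans (≡.sym (lookup∘tabulate f w)) ([]=⇒lookup w∈))

countᵇ-tabulate : ∀ {A : Set} {n} (p : A → Bool) (g : Fin n → A) →
                  countᵇ p (tabulate g) ≡ ∣ tabulate (p ∘ g) ∣
countᵇ-tabulate {n = 0}     p g = refl
countᵇ-tabulate {n = suc n} p g with p (g zero) | countᵇ-tabulate p (g ∘ suc)
... | true  | ih = cong suc ih
... | false | ih = ih

x∉p-x : ∀ {n} {x : Fin n} {p : Subset n} → x ∉ p - x
x∉p-x {x = zero}  {_ ∷ _} ()
x∉p-x {x = suc x} {_ ∷ _} (there x∈p-x) = x∉p-x x∈p-x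

two-elements⇒2≤∣p∣ : ∀ {n} {p : Subset n} {a b : Fin n} →
                     a ∈ p → b ∈ p → b ≢ a → 2 ≤ ∣ p ∣
two-elements⇒2≤∣p∣ {p = p} {a} a∈p b∈p b≢a =
  ≤-trans (s≤s 1≤∣p-a∣) (x∈p⇒∣p-x∣<∣p∣ a∈p)
  where
  1≤∣p-a∣ : 1 ≤ ∣ p - a ∣
  1≤∣p-a∣ = ≤-trans (s≤s z≤n) (x∈p⇒∣p-x∣<∣p∣ (x∈p∧x≢y⇒x∈p-y b∈p b≢a))

∣p∣≡1⇒unique : ∀ {n} {p : Subset n} {a b : Fin n} →
               ∣ p ∣ ≡ 1 → a ∈ p → b ∈ p → a ≡ b
∣p∣≡1⇒unique {a = a} {b} ∣p∣≡1 a∈p b∈p with b ≟ a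
... | yes b≡a = ≡.sym b≡a
... | no b≢a  = contradiction (subst (2 ≤_) ∣p∣≡1 (two-elements⇒2≤∣p∣ a∈p b∈p b≢a)) λ { (s≤s ()) }

unique⇒∣p∣≡1 : ∀ {n} {p : Subset n} {v : Fin n} →
               v ∈ p → (∀ {w} → w ∈ p → w ≡ v) → ∣ p ∣ ≡ 1
unique⇒∣p∣≡1 {p = p} {v} v∈p only-v =
  ≡.trans (cong ∣_∣ (⊆-antisym p⊆⁅v⁆ ⁅v⁆⊆p)) (∣⁅x⁆∣≡1 v)
  where
  p⊆⁅v⁆ : p ⊆ ⁅ v ⁆
  p⊆⁅v⁆ w∈p = subst (_∈ ⁅ v ⁆) (≡.sym (only-v w∈p)) (x∈⁅x⁆ v)
  ⁅v⁆⊆p : ⁅ v ⁆ ⊆ p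
  ⁅v⁆⊆p w∈⁅v⁆ = subst (_∈ p) (≡.sym (x∈⁅y⁆⇒x≡y v w∈⁅v⁆)) v∈p

module _ {n : ℕ} (G : Graph n) where

  adj-sym : ∀ {u w} → Adj G u w → Adj G w u
  adj-sym {u} {w} = subst T (Graph.sym G u w)

  adj-irrefl : ∀ {v} → ¬ Adj G v v
  adj-irrefl {v} = subst T (Graph.irrefl G v)

  neighbourhood : Fin n → Subset n
  neighbourhood u = tabulate (adj G u)

  degree≡∣neighbourhood∣ : ∀ u → degree G u ≡ ∣ neighbourhood u ∣
  degree≡∣neighbourhood∣ u = countᵇ-tabulate (adj G u) id

  leaf-unique-neighbour : ∀ {u a b} → T (isLeaf G u) → Adj G u a → Adj G u b → a ≡ b
  leaf-unique-neighbour {u} leaf ua ub =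
    ∣p∣≡1⇒unique (≡.trans (≡.sym (degree≡∣neighbourhood∣ u)) (≡ᵇ⇒≡ _ 1 leaf))
                 (T⇒∈tabulate ua) (T⇒∈tabulate ub)

  unique-neighbour⇒leaf : ∀ {u v} → Adj G u v → (∀ {w} → Adj G u w → w ≡ v) → T (isLeaf G u)
  unique-neighbour⇒leaf {u} uv only-v =
    ≡⇒≡ᵇ _ 1 (≡.trans (degree≡∣neighbourhood∣ u)
                       (unique⇒∣p∣≡1 (T⇒∈tabulate uv) (only-v ∘ ∈tabulate⇒T)))

  walk-closed : (P : Fin n → Set) → (∀ {a b} → P a → Adj G a b → P b) →
                ∀ {u y k} → P u → Walk G u y k → P y
  walk-closed P closed Pu here         = Pu
  walk-closed P closed Pu (step ab ps) = walk-closed P closed (closed Pu ab) ps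

  adjacent-leaves-span : Connected G → ∀ {u x} → T (isLeaf G u) → T (isLeaf G x) →
                         Adj G u x → ∀ y → y ≡ u ⊎ y ≡ x
  adjacent-leaves-span conn {u} {x} lu lx ux y =
    walk-closed (λ c → c ≡ u ⊎ c ≡ x) closed (inj₁ refl) (proj₂ (conn u y))
    where
    closed : ∀ {a b} → a ≡ u ⊎ a ≡ x → Adj G a b → b ≡ u ⊎ b ≡ x
    closed (inj₁ refl) ab = inj₂ (leaf-unique-neighbour lu ab ux)
    closed (inj₂ refl) ab = inj₁ (leaf-unique-neighbour lx ab (adj-sym ux))

  leaves-nonadjacent : Connected G → ∀ {v} → ¬ T (isLeaf G v) →
                       ∀ {u x} → T (isLeaf G u) → T (isLeaf G x) → ¬ Adj G u x
  leaves-nonadjacent conn {v} v-nonleaf lu lx ux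
    with adjacent-leaves-span conn lu lx ux v
  ... | inj₁ refl = v-nonleaf lu
  ... | inj₂ refl = v-nonleaf lx

  first-step : ∀ {u y k} → Walk G u y k → u ≢ y → ∃ λ w → Adj G u w
  first-step here                u≢u = contradiction refl u≢u
  first-step (step {v = w} uw _) _   = w , uw

  diameter-distinct : ∀ {d} → DiamAtLeast G (suc d) → ∃ λ a → ∃ λ b → a ≢ b
  diameter-distinct (a , b , dist) = a , b , λ { refl → contradiction (dist 0 here) λ () }

  no-isolated-vertex : Connected G → ∀ {d} → DiamAtLeast G (suc d) → ∀ u → ∃ λ w → Adj G u w
  no-isolated-vertex conn diam u with diameter-distinct diam
  ... | a , b , a≢b with u ≟ a
  ...   | no u≢a   = first-step (proj₂ (conn u a)) u≢a
  ...   | yes refl = first-step (proj₂ (conn u b)) a≢b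

  leaf-neighbour? : ∀ u → Dec (∃ λ w → Adj G u w × T (isLeaf G w))
  leaf-neighbour? u = any? (λ w → T? (adj G u w) ×-dec T? (isLeaf G w))

module Removal {n : ℕ} (G : Graph n) (conn : Connected G)
  (has-neighbour : ∀ u → ∃ λ w → Adj G u w)
  (no-isolated-support : ∀ u → ¬ IsIsolatedSupport G u)
  (v : Fin n) (v-nonleaf : ¬ T (isLeaf G v))
  (v-no-leaf-neighbour : ∀ {w} → Adj G v w → ¬ T (isLeaf G w)) where

  D : Subset n
  D = ∁ (leaves G) - v

  ∣D∣<n∸∣L∣ : ∣ D ∣ < n ∸ ∣ leaves G ∣
  ∣D∣<n∸∣L∣ = subst (∣ D ∣ <_) (∣∁p∣≡n∸∣p∣ (leaves G))
                (x∈p⇒∣p-x∣<∣p∣ (x∉p⇒x∈∁p (v-nonleaf ∘ ∈tabulate⇒T {f = isLeaf G})))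

  Outside : Fin n → Set
  Outside w = T (isLeaf G w) ⊎ w ≡ v

  outside-D : ∀ {w} → w ∉ D → Outside w
  outside-D {w} w∉D with T? (isLeaf G w) | w ≟ v
  ... | yes leaf   | _        = inj₁ leaf
  ... | no _       | yes w≡v  = inj₂ w≡v
  ... | no nonleaf | no w≢v   =
    contradiction (x∈p∧x≢y⇒x∈p-y (x∉p⇒x∈∁p (nonleaf ∘ ∈tabulate⇒T)) w≢v) w∉D

  v-not-support : ¬ IsSupport G v
  v-not-support (_ , w , vw , leaf) = v-no-leaf-neighbour vw leaf

  outside-independent : ∀ {a b} → Outside a → Outside b → ¬ Adj G a b
  outside-independent (inj₁ la)   (inj₁ lb)   = leaves-nonadjacent G conn v-nonleaf la lb
  outside-independent (inj₁ la)   (inj₂ refl) = λ av → v-no-leaf-neighbour (adj-sym G av) la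
  outside-independent (inj₂ refl) (inj₁ lb)   = λ vb → v-no-leaf-neighbour vb lb
  outside-independent (inj₂ refl) (inj₂ refl) = adj-irrefl G

  not-all-neighbours-outside : ∀ u → ¬ (∀ {w} → Adj G u w → Outside w)
  not-all-neighbours-outside u out with T? (isLeaf G u) | has-neighbour u
  ... | yes leaf    | x , ux = outside-independent (inj₁ leaf) (out ux) ux
  ... | no nonleaf  | x , ux with leaf-neighbour? G u
  ...   | yes (w , uw , lw) = no-isolated-support u ((nonleaf , w , uw , lw) , isolated)
    where
    isolated : ∀ z → Adj G u z → ¬ IsSupport G z
    isolated z uz sz = [ proj₁ sz , (λ { refl → v-not-support sz }) ] (out uz)
  ...   | no no-leaf-neighbour = nonleaf (unique-neighbour⇒leaf G (subst (Adj G u) (only-v ux) ux) only-v)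
    where
    only-v : ∀ {w} → Adj G u w → w ≡ v
    only-v uw = [ (λ lw → ⊥-elim (no-leaf-neighbour (_ , uw , lw))) , id ] (out uw)

  dominating : TotalDominating G D
  dominating u with any? (λ w → T? (adj G u w) ×-dec (w ∈? D))
  ... | yes (w , uw , w∈D) = w , uw , w∈D
  ... | no none = ⊥-elim (not-all-neighbours-outside u λ uw → outside-D λ w∈D → none (_ , uw , w∈D))

  D-total-co-independent : TotalCoIndDominating G D
  D-total-co-independent =
    dominating , (v , x∉p-x) , λ a b a∉D b∉D → outside-independent (outside-D a∉D) (outside-D b∉D)

corollary8 : (n : ℕ) (G : Graph n) → IsTree G → DiamAtLeast G 3
    → GammaTCoiIs G (n ∸ ∣ leaves G ∣)
    → (∀ v → ¬ IsIsolatedSupport G v)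
    → ∀ v → T (isLeaf G v) ⊎ IsSupport G v
corollary8 n G (conn , _) diam (_ , minimal) no-isolated-support v
  with T? (isLeaf G v)
... | yes leaf = inj₁ leaf
... | no nonleaf with leaf-neighbour? G v
...   | yes (w , vw , lw) = inj₂ (nonleaf , w , vw , lw)
...   | no no-leaf-neighbour =
  contradiction (minimal D D-total-co-independent) (<⇒≱ ∣D∣<n∸∣L∣)
  where
  open Removal G conn (no-isolated-vertex G conn diam) no-isolated-support
               v nonleaf (λ vw lw → no-leaf-neighbour (_ , vw , lw))
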